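{- Let $\Theta:\operatorname{PM}\to\operatorname{PM}$ be defined as follows: if $P\in\operatorname{IPPM}$ then $\Theta(P)=P$; if $P\in\operatorname{PM}\setminus\operatorname{IPPM}$, let $i$ be the smallest proper ascent or proper descent of $P$ and let $\Theta(P)$ be the matrix obtained from $P$ by interchanging the positions of the elements $i$ and $i+1$. Then $\Theta$ is a weight-preserving involution on $\operatorname{PM}$ that fixes every element of $\operatorname{IPPM}$, and for every $P\in\operatorname{PM}\setminus\operatorname{IPPM}$, $$|\operatorname{inv}(P)-\operatorname{inv}(\Theta(P))|=1.$$ Moreover, $\operatorname{inv}(P)\equiv 0\pmod 2$ for every $P\in\operatorname{IPPM}$. Consequently, for every $n\ge1$, $$|\operatorname{IPPM}_n|=\sum_{P\in\operatorname{PM}_n}(-1)^{\operatorname{inv}(P)}.$$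
   Context: For $n\ge1$ let $[n]=\{1,\ldots,n\}$. A partition matrix on $[n]$ is an upper-triangular square matrix whose entries are subsets of $[n]$ (entries below the diagonal are empty) such that: each row and each column contains at least one nonempty entry; the nonempty entries form a set partition of $[n]$; and for all $i,j\in[n]$, if $\operatorname{col}(i)<\operatorname{col}(j)$ then $i<j$, where $\operatorname{col}(k)$ (resp. $\operatorname{row}(k)$) is the column (resp. row) index of the entry containing $k$. Its weight is $n$. $\operatorname{PM}_n$ is the set of partition matrices on $[n]$ and $\operatorname{PM}=\bigcup_{n\ge1}\operatorname{PM}_n$. An inversion of $P$ is a pair $(i,j)$ with $i>j$, $\operatorname{col}(i)=\operatorname{col}(j)$, $\operatorname{row}(i)<\operatorname{row}(j)$; $\operatorname{inv}(P)$ is the number of inversions. For $1<i<n$, $i$ is a descent (resp. ascent) of $P$ if $\operatorname{col}(i)=\operatorname{col}(i+1)$ and $\operatorname{row}(i)>\operatorname{row}(i+1)$ (resp. $\operatorname{row}(i)<\operatorname{row}(i+1)$). A descent or ascent $i$ is proper if $i\equiv j\pmod 2$, where $j$ is the minimal element lying in column $\operatorname{col}(i)$ of $P$, and improper otherwise. $\operatorname{IPPM}$ (improper partition matrices) is the set of partition matrices all of whose descents and ascents (if any) are improper, and $\operatorname{IPPM}_n=\operatorname{IPPM}\cap\operatorname{PM}_n$. -}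

module Defs where

open import Data.Nat as ℕ using (ℕ; zero; suc; _%_)
import Data.Nat.Properties as ℕP
open import Data.Fin as F using (Fin; toℕ)
import Data.Fin.Properties as FP
open import Data.Product using (Σ; ∃; _×_; _,_; proj₁; proj₂)
open import Data.Product.Relation.Binary.Pointwise.NonDependent using ()
open import Data.Sum using (_⊎_)
open import Data.Vec as V using (Vec; []; _∷_; lookup; _[_]≔_)
open import Data.List as L using (List; []; _∷_; length; filter; concatMap; upTo; allFin; cartesianProduct)
open import Data.Maybe using (Maybe; just; nothing)
open import Data.Integer as ℤ using (ℤ; -1ℤ)
open import Relation.Nullary using (¬_; Dec; yes; no; ¬?)
open import Relation.Nullary.Decidable using (_×-dec_; _⊎-dec_; _→-dec_)
open import Relation.Binary.PropositionalEquality using (_≡_)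
open import Relation.Unary using (Decidable)

-- The element k of [n] is represented by  k' : Fin n  with toℕ k' + 1 = k.
-- The matrix is an m × m matrix; pos k = (row k , col k), 0-indexed.
-- The matrix (its entries as subsets of [n]) is exactly determined by
-- (n , m , pos): entry (r , c) = { k | pos k = (r , c) }.

record RawPM : Set where
  constructor mkRaw
  field
    n   : ℕ
    m   : ℕ
    pos : Vec (Fin m × Fin m) n

open RawPM public

weight : RawPM → ℕ
weight P = n P

row : (P : RawPM) → Fin (n P) → Fin (m P)
row P k = proj₁ (lookup (pos P) k)

col : (P : RawPM) → Fin (n P) → Fin (m P)
col P k = proj₂ (lookup (pos P) k)

-- P is a partition matrix: upper triangular, every row and every column
-- has a nonempty entry, and col(i) < col(j) ⇒ i < j.
-- (The nonempty entries automatically form a set partition of [n].)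
IsPM : RawPM → Set
IsPM P =
  (∀ k → row P k F.≤ col P k)
  × (∀ r → ∃ λ k → row P k ≡ r)
  × (∀ c → ∃ λ k → col P k ≡ c)
  × (∀ i j → col P i F.< col P j → i F.< j)

-- i is a descent (at position i, with i+1 = j), 1 < i < n  (1-indexed).
DescentAt : (P : RawPM) → Fin (n P) → Fin (n P) → Set
DescentAt P i j =
  toℕ j ≡ suc (toℕ i) × 1 ℕ.≤ toℕ i × col P i ≡ col P j × row P j F.< row P i

AscentAt : (P : RawPM) → Fin (n P) → Fin (n P) → Set
AscentAt P i j =
  toℕ j ≡ suc (toℕ i) × 1 ℕ.≤ toℕ i × col P i ≡ col P j × row P i F.< row P j

Descent : (P : RawPM) → Fin (n P) → Set
Descent P i = ∃ λ j → DescentAt P i j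

Ascent : (P : RawPM) → Fin (n P) → Set
Ascent P i = ∃ λ j → AscentAt P i j

IsMinInCol : (P : RawPM) → Fin (n P) → Fin (m P) → Set
IsMinInCol P j c = col P j ≡ c × (∀ k → col P k ≡ c → j F.≤ k)

-- i is proper: i ≡ j (mod 2) for j the minimal element of column col(i)
-- (parities of 1-indexed values agree iff parities of 0-indexed ones do).
Proper : (P : RawPM) → Fin (n P) → Set
Proper P i = ∃ λ j → IsMinInCol P j (col P i) × toℕ j % 2 ≡ toℕ i % 2

IsIPPM : RawPM → Set
IsIPPM P = IsPM P × (∀ i → Descent P i ⊎ Ascent P i → ¬ Proper P i)

Inversion : (P : RawPM) → Fin (n P) × Fin (n P) → Set
Inversion P (i , j) = j F.< i × col P i ≡ col P j × row P i F.< row P j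

IsPM? : Decidable IsPM
IsPM? P =
  FP.all? (λ k → row P k FP.≤? col P k)
  ×-dec FP.all? (λ r → FP.any? (λ k → row P k FP.≟ r))
  ×-dec FP.all? (λ c → FP.any? (λ k → col P k FP.≟ c))
  ×-dec FP.all? (λ i → FP.all? (λ j → (col P i FP.<? col P j) →-dec (i FP.<? j)))

DescentAt? : (P : RawPM) → (ij : Fin (n P) × Fin (n P)) → Dec (DescentAt P (proj₁ ij) (proj₂ ij))
DescentAt? P (i , j) =
  (toℕ j ℕP.≟ suc (toℕ i)) ×-dec (1 ℕP.≤? toℕ i) ×-dec (col P i FP.≟ col P j) ×-dec (row P j FP.<? row P i)

AscentAt? : (P : RawPM) → (ij : Fin (n P) × Fin (n P)) → Dec (AscentAt P (proj₁ ij) (proj₂ ij))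
AscentAt? P (i , j) =
  (toℕ j ℕP.≟ suc (toℕ i)) ×-dec (1 ℕP.≤? toℕ i) ×-dec (col P i FP.≟ col P j) ×-dec (row P i FP.<? row P j)

Proper? : (P : RawPM) → (i : Fin (n P)) → Dec (Proper P i)
Proper? P i = FP.any? λ j →
  ((col P j FP.≟ col P i) ×-dec FP.all? (λ k → (col P k FP.≟ col P i) →-dec (j FP.≤? k)))
  ×-dec (toℕ j % 2 ℕP.≟ toℕ i % 2)

IsIPPM? : Decidable IsIPPM
IsIPPM? P = IsPM? P ×-dec FP.all? (λ i →
  ((FP.any? (λ j → DescentAt? P (i , j))) ⊎-dec (FP.any? (λ j → AscentAt? P (i , j))))
  →-dec ¬? (Proper? P i))

allPairs : (k : ℕ) → List (Fin k × Fin k)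
allPairs k = cartesianProduct (allFin k) (allFin k)

inv : RawPM → ℕ
inv P = length (filter (λ ij → dec ij) (allPairs (n P)))
  where
  dec : (ij : Fin (n P) × Fin (n P)) → Dec (Inversion P ij)
  dec (i , j) = (j FP.<? i) ×-dec (col P i FP.≟ col P j) ×-dec (row P i FP.<? row P j)

-- pairs (i , i+1) such that i is a proper descent or proper ascent;
-- listed in increasing order of i (allPairs is lexicographic).
properADs : (P : RawPM) → List (Fin (n P) × Fin (n P))
properADs P = filter (λ ij → (DescentAt? P ij ⊎-dec AscentAt? P ij) ×-dec Proper? P (proj₁ ij))
                     (allPairs (n P))

swapPos : (P : RawPM) → Fin (n P) → Fin (n P) → RawPM
swapPos P i j = mkRaw (n P) (m P) ((pos P [ i ]≔ lookup (pos P) j) [ j ]≔ lookup (pos P) i)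

Θ : RawPM → RawPM
Θ P with properADs P
... | []          = P
... | (i , j) ∷ _ = swapPos P i j

allVecs : {A : Set} → List A → (k : ℕ) → List (Vec A k)
allVecs xs zero    = [] ∷ []
allVecs xs (suc k) = concatMap (λ x → L.map (x ∷_) (allVecs xs k)) xs

-- all raw data of weight k with matrix size ≤ k (a partition matrix on [k]
-- has at most k rows since its rows are nonempty and disjoint)
allRaw : ℕ → List RawPM
allRaw k = concatMap (λ mm → L.map (mkRaw k mm) (allVecs (allPairs mm) k)) (upTo (suc k))

PMs : ℕ → List RawPM
PMs k = filter IsPM? (allRaw k)

IPPMs : ℕ → List RawPM
IPPMs k = filter IsIPPM? (PMs k)

sumℤ : List ℤ → ℤ
sumℤ = L.foldr ℤ._+_ (ℤ.+ 0)

signedSum : ℕ → ℤ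
signedSum k = sumℤ (L.map (λ P → -1ℤ ℤ.^ inv P) (PMs k))

-- Θ swaps i and i + 1, which lie in one column.  This keeps a partition matrix,
-- changes the inversion status of the pair {i, i + 1} only, and leaves the list of
-- proper ascents and descents unchanged, so Θ is an involution on PM ∖ IPPM that
-- reverses the sign (-1)^inv.  In an improper matrix pair every proper element x with
-- x + 1 when that lies in its column; partners lie in the same row, since otherwise x
-- would be a proper ascent or descent.  Replacing the larger member of an inversion by
-- its partner if it has one, and the smaller member otherwise, is a fixed-point-free
-- involution on inversions, so inv is even.  Hence in the sum of (-1)^inv over PM_n the
-- matrices outside IPPM cancel in pairs and each improper one contributes 1.

module Submission where

open import Defs
open import Data.Nat using (ℕ; _≤_; _%_; ∣_-_∣)
open import Data.Integer using (+_)
open import Data.List using (length)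
open import Data.Product using (_×_)
open import Relation.Nullary using (¬_)
open import Relation.Binary.PropositionalEquality using (_≡_)

open import Data.Nat as ℕ using (zero; suc; _+_; _<_; z≤n; s≤s)
import Data.Nat.Properties as ℕP
import Data.Nat.DivMod as ℕD
open import Data.Integer as ℤ using (ℤ; -_; -1ℤ; +[1+_]; -[1+_]; _^_)
import Data.Integer.Properties as ℤP
open import Data.List as L using (List; []; _∷_; filter; map; upTo)
import Data.List.Properties as LP
open import Data.List.Membership.Propositional using (_∈_; find)
import Data.List.Membership.Propositional.Properties as ∈P
open import Data.List.Membership.Propositional.Properties.WithK using (unique∧set⇒bag)
open import Data.List.Relation.Binary.BagAndSetEquality using (∼bag⇒↭)
open import Data.List.Relation.Binary.Permutation.Propositional using (_↭_; ↭⇒↭ₛ)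
import Data.List.Relation.Binary.Permutation.Propositional.Properties as ↭P
import Data.List.Relation.Binary.Permutation.Setoid.Properties as ↭ₛ
open import Data.List.Relation.Unary.All as All using ([])
import Data.List.Relation.Unary.All.Properties as AllP
open import Data.List.Relation.Unary.Any as Any using (here; there)
open import Data.List.Relation.Unary.Unique.Propositional using (Unique; []; _∷_)
import Data.List.Relation.Unary.Unique.Propositional.Properties as UniqueP
open import Data.Fin as F using (Fin; toℕ)
import Data.Fin.Properties as FP
open import Data.Fin.Permutation.Components using (transpose)
open import Data.Vec as V using (Vec; lookup; _[_]≔_)
import Data.Vec.Properties as VP
import Data.Product.Properties as ×P
open import Data.Product using (Σ; ∃; _,_; proj₁; proj₂)
open import Data.Sum as Sum using (_⊎_; inj₁; inj₂)
open import Data.Empty using (⊥; ⊥-elim)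
open import Function using (_∘_; mk⇔)
open import Relation.Nullary using (Dec; yes; no; ¬?)
open import Relation.Nullary.Decidable using (dec-true; dec-false; _×-dec_; _⊎-dec_)
open import Relation.Binary.Definitions using (DecidableEquality; tri<; tri≈; tri>)
open import Relation.Unary using (Pred; Decidable)
open import Relation.Binary.PropositionalEquality
  using (_≢_; refl; sym; trans; cong; cong₂; subst; subst₂; setoid; module ≡-Reasoning)

module _ {A : Set} where

  length-filter-cong : ∀ {p q} {P : Pred A p} {Q : Pred A q} (P? : Decidable P) (Q? : Decidable Q) xs →
    (∀ {x} → x ∈ xs → P x → Q x) → (∀ {x} → x ∈ xs → Q x → P x) →
    length (filter P? xs) ≡ length (filter Q? xs)
  length-filter-cong P? Q? [] _ _ = refl
  length-filter-cong P? Q? (x ∷ xs) P⇒Q Q⇒P with P? x | Q? x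
  ... | yes _  | yes _  = cong suc (length-filter-cong P? Q? xs (P⇒Q ∘ there) (Q⇒P ∘ there))
  ... | yes px | no ¬qx = ⊥-elim (¬qx (P⇒Q (here refl) px))
  ... | no ¬px | yes qx = ⊥-elim (¬px (Q⇒P (here refl) qx))
  ... | no _   | no _   = length-filter-cong P? Q? xs (P⇒Q ∘ there) (Q⇒P ∘ there)

  length-filter-except : DecidableEquality A → ∀ {p q} {P : Pred A p} {Q : Pred A q} (P? : Decidable P) (Q? : Decidable Q)
    {xs z} → Unique xs → z ∈ xs → P z → ¬ Q z →
    (∀ {x} → x ∈ xs → x ≢ z → P x → Q x) → (∀ {x} → x ∈ xs → x ≢ z → Q x → P x) →
    length (filter P? xs) ≡ suc (length (filter Q? xs))
  length-filter-except _≟_ P? Q? {x ∷ xs} {z} (x∉xs ∷ xs!) z∈ pz ¬qz P⇒Q Q⇒P with x ≟ z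
  ... | yes refl with P? x | Q? x
  ...   | no ¬pz | _      = ⊥-elim (¬pz pz)
  ...   | yes _  | yes qz = ⊥-elim (¬qz qz)
  ...   | yes _  | no _   =
    cong suc (length-filter-cong P? Q? xs (λ m → P⇒Q (there m) (x≢ m)) (λ m → Q⇒P (there m) (x≢ m)))
    where x≢ = λ {y} (m : y ∈ xs) (y≡x : y ≡ x) → All.lookup x∉xs m (sym y≡x)
  length-filter-except _≟_ P? Q? (_ ∷ _) (here z≡x) _ _ _ _ | no x≢z = ⊥-elim (x≢z (sym z≡x))
  length-filter-except _≟_ P? Q? {x ∷ xs} (_ ∷ xs!) (there z∈) pz ¬qz P⇒Q Q⇒P | no x≢z with P? x | Q? x
  ... | yes _  | yes _  = cong suc (length-filter-except _≟_ P? Q? xs! z∈ pz ¬qz (P⇒Q ∘ there) (Q⇒P ∘ there))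
  ... | yes px | no ¬qx = ⊥-elim (¬qx (P⇒Q (here refl) x≢z px))
  ... | no ¬px | yes qx = ⊥-elim (¬px (Q⇒P (here refl) x≢z qx))
  ... | no _   | no _   = length-filter-except _≟_ P? Q? xs! z∈ pz ¬qz (P⇒Q ∘ there) (Q⇒P ∘ there)

  length-filter+length-filter-¬ : ∀ {p} {P : Pred A p} (P? : Decidable P) xs →
    length xs ≡ length (filter P? xs) + length (filter (¬? ∘ P?) xs)
  length-filter+length-filter-¬ P? [] = refl
  length-filter+length-filter-¬ P? (x ∷ xs) with P? x
  ... | yes _ = cong suc (length-filter+length-filter-¬ P? xs)
  ... | no _  = trans (cong suc (length-filter+length-filter-¬ P? xs)) (sym (ℕP.+-suc _ _))

  length-filter-map : ∀ {p} {P : Pred A p} (P? : Decidable P) (f : A → A) xs →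
    length (filter P? (map f xs)) ≡ length (filter (P? ∘ f) xs)
  length-filter-map P? f [] = refl
  length-filter-map P? f (x ∷ xs) with P? (f x)
  ... | yes _ = cong suc (length-filter-map P? f xs)
  ... | no _  = length-filter-map P? f xs

  Unique-map⁺ : ∀ {B : Set} (f : A → B) {xs} → Unique xs →
    (∀ {x y} → x ∈ xs → y ∈ xs → f x ≡ f y → x ≡ y) → Unique (map f xs)
  Unique-map⁺ f {[]} [] _ = []
  Unique-map⁺ f {x ∷ xs} (x∉xs ∷ xs!) inj =
    AllP.map⁺ (All.tabulate λ y∈ fx≡fy → All.lookup x∉xs y∈ (inj (here refl) (there y∈) fx≡fy))
    ∷ Unique-map⁺ f xs! (λ x∈ y∈ → inj (there x∈) (there y∈))

Unique-concatMap⁺ : ∀ {A B : Set} (f : A → List B) (tag : B → A) {xs : List A} → Unique xs →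
  (∀ x → Unique (f x)) → (∀ {x y} → y ∈ f x → tag y ≡ x) → Unique (L.concatMap f xs)
Unique-concatMap⁺ f tag {[]} [] _ _ = []
Unique-concatMap⁺ f tag {x ∷ xs} (x∉xs ∷ xs!) f! tag-f =
  UniqueP.++⁺ (f! x) (Unique-concatMap⁺ f tag xs! f! tag-f) disjoint
  where
  disjoint : ∀ {y} → ¬ (y ∈ f x × y ∈ L.concatMap f xs)
  disjoint (y∈fx , y∈rest) with find (∈P.∈-concatMap⁻ f {xs = xs} y∈rest)
  ... | x′ , x′∈xs , y∈fx′ = All.lookup x∉xs x′∈xs (trans (sym (tag-f y∈fx)) (tag-f y∈fx′))

allVecs-unique : ∀ {A : Set} {xs : List A} → Unique xs → ∀ k → Unique (allVecs xs k)
allVecs-unique xs! zero    = [] ∷ []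
allVecs-unique {xs = xs} xs! (suc k) =
  Unique-concatMap⁺ (λ x → map (x V.∷_) (allVecs xs k)) V.head xs!
    (λ _ → UniqueP.map⁺ VP.∷-injectiveʳ (allVecs-unique xs! k))
    (λ {x} v∈ → let _ , _ , v≡ = ∈P.∈-map⁻ (x V.∷_) v∈ in cong V.head v≡)

∈-allVecs : ∀ {A : Set} {xs : List A} → (∀ x → x ∈ xs) → ∀ {k} (v : Vec A k) → v ∈ allVecs xs k
∈-allVecs all∈ V.[]       = here refl
∈-allVecs {xs = xs} all∈ (x V.∷ v) =
  ∈P.∈-concatMap⁺ (λ y → map (y V.∷_) (allVecs xs _)) {xs = xs}
    (Any.map (λ { refl → ∈P.∈-map⁺ (x V.∷_) (∈-allVecs all∈ v) }) (all∈ x))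

allPairs-unique : ∀ k → Unique (allPairs k)
allPairs-unique k = UniqueP.cartesianProduct⁺ (UniqueP.allFin⁺ k) (UniqueP.allFin⁺ k)

∈-allPairs : ∀ {k} (ab : Fin k × Fin k) → ab ∈ allPairs k
∈-allPairs (a , b) = ∈P.∈-cartesianProduct⁺ (∈P.∈-allFin a) (∈P.∈-allFin b)

suc-suc-%2 : ∀ x → suc (suc x) % 2 ≡ x % 2
suc-suc-%2 x = trans (cong (_% 2) (ℕP.+-comm 2 x)) (ℕD.[m+n]%n≡m%n x 2)

%2≢suc-%2 : ∀ x → x % 2 ≢ suc x % 2
%2≢suc-%2 zero ()
%2≢suc-%2 (suc zero) ()
%2≢suc-%2 (suc (suc x)) eq = %2≢suc-%2 x (trans (sym (suc-suc-%2 x)) (trans eq (suc-suc-%2 (suc x))))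

%2≢⇒suc-%2 : ∀ x y → x % 2 ≢ y % 2 → y % 2 ≡ suc x % 2
%2≢⇒suc-%2 zero          zero          ne = ⊥-elim (ne refl)
%2≢⇒suc-%2 zero          (suc zero)    ne = refl
%2≢⇒suc-%2 (suc zero)    zero          ne = refl
%2≢⇒suc-%2 (suc zero)    (suc zero)    ne = ⊥-elim (ne refl)
%2≢⇒suc-%2 (suc (suc x)) y             ne rewrite suc-suc-%2 x =
  trans (%2≢⇒suc-%2 x y ne) (sym (suc-suc-%2 (suc x)))
%2≢⇒suc-%2 zero          (suc (suc y)) ne rewrite suc-suc-%2 y = %2≢⇒suc-%2 zero y ne
%2≢⇒suc-%2 (suc zero)    (suc (suc y)) ne rewrite suc-suc-%2 y = %2≢⇒suc-%2 (suc zero) y ne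

[k+k]%2≡0 : ∀ k → (k + k) % 2 ≡ 0
[k+k]%2≡0 zero    = refl
[k+k]%2≡0 (suc k) = trans (cong (λ m → suc m % 2) (ℕP.+-suc k k)) (trans (suc-suc-%2 (k + k)) ([k+k]%2≡0 k))

-1^suc : ∀ x → -1ℤ ^ suc x ≡ - (-1ℤ ^ x)
-1^suc x = ℤP.-1*i≡-i (-1ℤ ^ x)

-1^even : ∀ x → x % 2 ≡ 0 → -1ℤ ^ x ≡ + 1
-1^even zero          _  = refl
-1^even (suc zero)    ()
-1^even (suc (suc x)) x%2 = begin
  -1ℤ ^ suc (suc x) ≡⟨ -1^suc (suc x) ⟩
  - (-1ℤ ^ suc x)   ≡⟨ cong -_ (-1^suc x) ⟩
  - - (-1ℤ ^ x)     ≡⟨ ℤP.neg-involutive _ ⟩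
  -1ℤ ^ x           ≡⟨ -1^even x (trans (sym (suc-suc-%2 x)) x%2) ⟩
  + 1               ∎
  where open ≡-Reasoning

i≡-i⇒i≡0 : ∀ {i} → i ≡ - i → i ≡ + 0
i≡-i⇒i≡0 {+ zero} _ = refl
i≡-i⇒i≡0 {+[1+ _ ]} ()
i≡-i⇒i≡0 { -[1+ _ ]} ()

sumℤ-↭ : ∀ {xs ys} → xs ↭ ys → sumℤ xs ≡ sumℤ ys
sumℤ-↭ xs↭ys = ↭ₛ.foldr-commMonoid (setoid ℤ) ℤP.+-0-isCommutativeMonoid (↭⇒↭ₛ xs↭ys)

sumℤ-map-neg : ∀ {A : Set} (g : A → ℤ) xs → sumℤ (map (-_ ∘ g) xs) ≡ - sumℤ (map g xs)
sumℤ-map-neg g []       = refl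
sumℤ-map-neg g (x ∷ xs) =
  trans (cong (ℤ._+_ (- g x)) (sumℤ-map-neg g xs)) (sym (ℤP.neg-distrib-+ (g x) _))

sumℤ-partition : ∀ {A : Set} {p} {Q : Pred A p} (Q? : Decidable Q) (g : A → ℤ) xs →
  sumℤ (map g xs) ≡ sumℤ (map g (filter Q? xs)) ℤ.+ sumℤ (map g (filter (¬? ∘ Q?) xs))
sumℤ-partition Q? g [] = refl
sumℤ-partition Q? g (x ∷ xs) with Q? x
... | yes _ = trans (cong (ℤ._+_ (g x)) (sumℤ-partition Q? g xs)) (sym (ℤP.+-assoc (g x) _ _))
... | no _  = begin
  g x ℤ.+ sumℤ (map g xs) ≡⟨ cong (ℤ._+_ (g x)) (sumℤ-partition Q? g xs) ⟩
  g x ℤ.+ (S⁺ ℤ.+ S⁻) ≡⟨ ℤP.+-assoc (g x) S⁺ S⁻ ⟨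
  (g x ℤ.+ S⁺) ℤ.+ S⁻ ≡⟨ cong (ℤ._+ S⁻) (ℤP.+-comm (g x) S⁺) ⟩
  (S⁺ ℤ.+ g x) ℤ.+ S⁻ ≡⟨ ℤP.+-assoc S⁺ (g x) S⁻ ⟩
  S⁺ ℤ.+ (g x ℤ.+ S⁻) ∎
  where
  open ≡-Reasoning
  S⁺ = sumℤ (map g (filter Q? xs))
  S⁻ = sumℤ (map g (filter (¬? ∘ Q?) xs))

sumℤ-ones : ∀ {A : Set} (g : A → ℤ) xs → (∀ {x} → x ∈ xs → g x ≡ + 1) → sumℤ (map g xs) ≡ + length xs
sumℤ-ones g []       _    = refl
sumℤ-ones g (x ∷ xs) g≡1 =
  trans (cong₂ ℤ._+_ (g≡1 (here refl)) (sumℤ-ones g xs (g≡1 ∘ there))) (sym (ℤP.pos-+ 1 (length xs)))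

∣m-n∣≡1 : ∀ {a b} → b ≡ suc a ⊎ a ≡ suc b → ∣ a - b ∣ ≡ 1
∣m-n∣≡1 {a} (inj₁ refl) = subst (λ x → ∣ a - x ∣ ≡ 1) (ℕP.+-comm a 1) (ℕP.∣m-m+n∣≡n a 1)
∣m-n∣≡1 {b = b} (inj₂ refl) =
  trans (ℕP.∣-∣-comm (suc b) b) (subst (λ x → ∣ b - x ∣ ≡ 1) (ℕP.+-comm b 1) (ℕP.∣m-m+n∣≡n b 1))

module _ {A : Set} {f : A → A} {xs : List A} (xs! : Unique xs)
         (f-∈ : ∀ {x} → x ∈ xs → f x ∈ xs) (f-involutive : ∀ {x} → x ∈ xs → f (f x) ≡ x) where

  involution-↭ : xs ↭ map f xs
  involution-↭ = ∼bag⇒↭ (unique∧set⇒bag xs! fxs! (mk⇔ to from))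
    where
    fxs! : Unique (map f xs)
    fxs! = Unique-map⁺ f xs! λ x∈ y∈ fx≡fy →
      trans (sym (f-involutive x∈)) (trans (cong f fx≡fy) (f-involutive y∈))
    to : ∀ {x} → x ∈ xs → x ∈ map f xs
    to x∈ = subst (_∈ map f xs) (f-involutive x∈) (∈P.∈-map⁺ f (f-∈ x∈))
    from : ∀ {x} → x ∈ map f xs → x ∈ xs
    from y∈ with ∈P.∈-map⁻ f y∈
    ... | _ , x∈ , refl = f-∈ x∈

  sumℤ-signReversing : (g : A → ℤ) → (∀ {x} → x ∈ xs → g (f x) ≡ - g x) → sumℤ (map g xs) ≡ + 0
  sumℤ-signReversing g g∘f≡-g = i≡-i⇒i≡0 (begin
    sumℤ (map g xs)         ≡⟨ sumℤ-↭ (↭P.map⁺ g involution-↭) ⟩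
    sumℤ (map g (map f xs)) ≡⟨ cong sumℤ (LP.map-∘ xs) ⟨
    sumℤ (map (g ∘ f) xs)   ≡⟨ cong sumℤ (LP.map-cong-local (All.tabulate g∘f≡-g)) ⟩
    sumℤ (map (-_ ∘ g) xs)  ≡⟨ sumℤ-map-neg g xs ⟩
    - sumℤ (map g xs)       ∎)
    where open ≡-Reasoning

  -- The weight w only serves to pick one member of each two-element orbit of f.
  fixedPointFree-length-even : (w : A → ℕ) → (∀ {x} → x ∈ xs → w (f x) ≢ w x) → length xs % 2 ≡ 0
  fixedPointFree-length-even w w∘f≢w = subst (λ m → m % 2 ≡ 0) (sym length≡k+k) ([k+k]%2≡0 k)
    where
    up? : Decidable (λ x → w x < w (f x))
    up? x = w x ℕP.<? w (f x)
    k = length (filter up? xs)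
    down≡up∘f : length (filter (¬? ∘ up?) xs) ≡ length (filter (up? ∘ f) xs)
    down≡up∘f = length-filter-cong (¬? ∘ up?) (up? ∘ f) xs
      (λ x∈ ¬up → subst (λ y → w (f _) < w y) (sym (f-involutive x∈))
                        (ℕP.≤∧≢⇒< (ℕP.≮⇒≥ ¬up) (w∘f≢w x∈)))
      (λ x∈ up∘f up → ℕP.<-asym up (subst (λ y → w (f _) < w y) (f-involutive x∈) up∘f))
    length≡k+k : length xs ≡ k + k
    length≡k+k = begin
      length xs                                     ≡⟨ length-filter+length-filter-¬ up? xs ⟩
      k + length (filter (¬? ∘ up?) xs)             ≡⟨ cong (_+_ k) down≡up∘f ⟩
      k + length (filter (up? ∘ f) xs)              ≡⟨ cong (_+_ k) (length-filter-map up? f xs) ⟨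
      k + length (filter up? (map f xs))            ≡⟨ cong (_+_ k) (↭P.↭-length (↭P.filter-↭ up? involution-↭)) ⟨
      k + k                                         ∎
      where open ≡-Reasoning

data Which {n} (i j k : Fin n) : Set where
  is-i    : k ≡ i → Which i j k
  is-j    : k ≡ j → Which i j k
  neither : k ≢ i → k ≢ j → Which i j k

which : ∀ {n} (i j k : Fin n) → Which i j k
which i j k with k FP.≟ i | k FP.≟ j
... | yes k≡i | _       = is-i k≡i
... | no _    | yes k≡j = is-j k≡j
... | no k≢i  | no k≢j  = neither k≢i k≢j

transpose-matchˡ : ∀ {n} (i j : Fin n) → transpose i j i ≡ j
transpose-matchˡ i j rewrite dec-true (i FP.≟ i) refl = refl

transpose-matchʳ : ∀ {n} (i j : Fin n) → transpose i j j ≡ i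
transpose-matchʳ i j with j FP.≟ i
... | yes refl = refl
... | no _ rewrite dec-true (j FP.≟ j) refl = refl

transpose-mismatch : ∀ {n} {i j k : Fin n} → k ≢ i → k ≢ j → transpose i j k ≡ k
transpose-mismatch {i = i} {j} {k} k≢i k≢j
  rewrite dec-false (k FP.≟ i) k≢i | dec-false (k FP.≟ j) k≢j = refl

transpose-involutive : ∀ {n} (i j k : Fin n) → transpose i j (transpose i j k) ≡ k
transpose-involutive i j k with which i j k
... | is-i refl = trans (cong (transpose i j) (transpose-matchˡ i j)) (transpose-matchʳ i j)
... | is-j refl = trans (cong (transpose i j) (transpose-matchʳ i j)) (transpose-matchˡ i j)
... | neither k≢i k≢j = trans (cong (transpose i j) τk≡k) τk≡k
  where τk≡k = transpose-mismatch k≢i k≢j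

lookup-swap : ∀ {A : Set} {n} (u : Vec A n) {i j : Fin n} → i ≢ j → ∀ k →
  lookup ((u [ i ]≔ lookup u j) [ j ]≔ lookup u i) k ≡ lookup u (transpose i j k)
lookup-swap u {i} {j} i≢j k with which i j k
... | is-i refl = begin
  lookup ((u [ i ]≔ lookup u j) [ j ]≔ lookup u i) i ≡⟨ VP.lookup∘update′ i≢j (u [ i ]≔ lookup u j) _ ⟩
  lookup (u [ i ]≔ lookup u j) i                     ≡⟨ VP.lookup∘update i u _ ⟩
  lookup u j                                         ≡⟨ cong (lookup u) (transpose-matchˡ i j) ⟨
  lookup u (transpose i j i)                         ∎
  where open ≡-Reasoning
... | is-j refl = trans (VP.lookup∘update j (u [ i ]≔ lookup u j) _) (cong (lookup u) (sym (transpose-matchʳ i j)))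
... | neither k≢i k≢j = begin
  lookup ((u [ i ]≔ lookup u j) [ j ]≔ lookup u i) k ≡⟨ VP.lookup∘update′ k≢j (u [ i ]≔ lookup u j) _ ⟩
  lookup (u [ i ]≔ lookup u j) k                     ≡⟨ VP.lookup∘update′ k≢i u _ ⟩
  lookup u k                                         ≡⟨ cong (lookup u) (transpose-mismatch k≢i k≢j) ⟨
  lookup u (transpose i j k)                         ∎
  where open ≡-Reasoning

least : ∀ {k p} {Q : Pred (Fin k) p} → Decidable Q → ∀ {x} → Q x →
  Σ (Fin k) λ w → Q w × (∀ y → Q y → w F.≤ y)
least {suc k} Q? {x} qx with Q? F.zero
... | yes q0 = F.zero , q0 , λ _ _ → z≤n
least {suc k} Q? {F.zero}  qx | no ¬q0 = ⊥-elim (¬q0 qx)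
least {suc k} Q? {F.suc x} qx | no ¬q0 with least (Q? ∘ F.suc) qx
... | w , qw , w≤ = F.suc w , qw , λ { F.zero q0 → ⊥-elim (¬q0 q0) ; (F.suc y) qy → s≤s (w≤ y qy) }

predecessor : ∀ {k} {w x : Fin k} → w F.< x → Σ (Fin k) λ y → toℕ x ≡ suc (toℕ y)
predecessor {x = F.suc y} _ = F.inject₁ y , cong suc (sym (FP.toℕ-inject₁ y))

IsMinInCol-unique : (P : RawPM) {w w′ : Fin (n P)} {c : Fin (m P)} →
  IsMinInCol P w c → IsMinInCol P w′ c → w ≡ w′
IsMinInCol-unique P (cw , w≤) (cw′ , w′≤) = FP.≤-antisym (w≤ _ cw′) (w′≤ _ cw)

¬proper-adjacent : (P : RawPM) {x y : Fin (n P)} → toℕ y ≡ suc (toℕ x) → col P x ≡ col P y →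
  Proper P x → Proper P y → ⊥
¬proper-adjacent P {x} y≡1+x cx≡cy (w , w-min , w≡x) (w′ , w′-min , w′≡y)
  rewrite cx≡cy | IsMinInCol-unique P w-min w′-min | y≡1+x =
  %2≢suc-%2 (toℕ x) (trans (sym w≡x) w′≡y)

Proper-resp-col : ∀ {n m} {u v : Vec (Fin m × Fin m) n} →
  (∀ k → col (mkRaw n m u) k ≡ col (mkRaw n m v) k) →
  ∀ {k} → Proper (mkRaw n m u) k → Proper (mkRaw n m v) k
Proper-resp-col col≗ {k} (w , (cw , w≤) , w≡k) =
  w , (trans (sym (col≗ w)) (trans cw (col≗ k)) , λ l cl → w≤ l (trans (col≗ l) (trans cl (sym (col≗ k))))) , w≡k

AscentOrDescentAt : (P : RawPM) → Fin (n P) → Fin (n P) → Set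
AscentOrDescentAt P a b = toℕ b ≡ suc (toℕ a) × 1 ℕ.≤ toℕ a × col P a ≡ col P b × row P a ≢ row P b

module _ (P : RawPM) {a b : Fin (n P)} where

  ascentOrDescent⁺ : DescentAt P a b ⊎ AscentAt P a b → AscentOrDescentAt P a b
  ascentOrDescent⁺ (inj₁ (b≡1+a , 1≤a , ca≡cb , rb<ra)) = b≡1+a , 1≤a , ca≡cb , FP.<⇒≢ rb<ra ∘ sym
  ascentOrDescent⁺ (inj₂ (b≡1+a , 1≤a , ca≡cb , ra<rb)) = b≡1+a , 1≤a , ca≡cb , FP.<⇒≢ ra<rb

  ascentOrDescent⁻ : AscentOrDescentAt P a b → DescentAt P a b ⊎ AscentAt P a b
  ascentOrDescent⁻ (b≡1+a , 1≤a , ca≡cb , ra≢rb) with FP.<-cmp (row P a) (row P b)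
  ... | tri< ra<rb _ _ = inj₂ (b≡1+a , 1≤a , ca≡cb , ra<rb)
  ... | tri≈ _ ra≡rb _ = ⊥-elim (ra≢rb ra≡rb)
  ... | tri> _ _ rb<ra = inj₁ (b≡1+a , 1≤a , ca≡cb , rb<ra)

-- The tests used by properADs and inv, which therefore unfold to filters over allPairs.

ProperAD : (P : RawPM) → Fin (n P) × Fin (n P) → Set
ProperAD P (a , b) = (DescentAt P a b ⊎ AscentAt P a b) × Proper P a

ProperAD? : (P : RawPM) → Decidable (ProperAD P)
ProperAD? P ab = (DescentAt? P ab ⊎-dec AscentAt? P ab) ×-dec Proper? P (proj₁ ab)

Inversion? : (P : RawPM) → Decidable (Inversion P)
Inversion? P (a , b) = (b FP.<? a) ×-dec (col P a FP.≟ col P b) ×-dec (row P a FP.<? row P b)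

allRaw-unique : ∀ k → Unique (allRaw k)
allRaw-unique k = Unique-concatMap⁺ _ m (UniqueP.upTo⁺ (suc k))
  (λ mm → UniqueP.map⁺ (λ { refl → refl }) (allVecs-unique (allPairs-unique mm) k))
  (λ {mm} P∈ → let _ , _ , P≡ = ∈P.∈-map⁻ (mkRaw k mm) P∈ in cong m P≡)

∈-allRaw : ∀ P → m P ℕ.≤ n P → P ∈ allRaw (n P)
∈-allRaw P m≤n =
  ∈P.∈-concatMap⁺ (λ mm → map (mkRaw (n P) mm) (allVecs (allPairs mm) (n P))) {xs = upTo (suc (n P))}
  (Any.map (λ { refl → ∈P.∈-map⁺ (mkRaw (n P) (m P)) (∈-allVecs ∈-allPairs (pos P)) }) (∈P.∈-upTo⁺ (s≤s m≤n)))

∈-allRaw⁻ : ∀ {k P} → P ∈ allRaw k → n P ≡ k × m P ℕ.≤ k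
∈-allRaw⁻ {k} P∈
  with find (∈P.∈-concatMap⁻ (λ mm → map (mkRaw k mm) (allVecs (allPairs mm) k)) {xs = upTo (suc k)} P∈)
... | mm , mm∈ , P∈′ with ∈P.∈-map⁻ (mkRaw k mm) P∈′
...   | _ , _ , refl = refl , ℕ.s≤s⁻¹ (∈P.∈-upTo⁻ mm∈)

module AdjacentSwap (P : RawPM) (i j : Fin (n P))
                    (j≡1+i : toℕ j ≡ suc (toℕ i)) (ci≡cj : col P i ≡ col P j) where

  Q : RawPM
  Q = swapPos P i j

  τ : Fin (n P) → Fin (n P)
  τ = transpose i j

  σ : Fin (n P) × Fin (n P) → Fin (n P) × Fin (n P)
  σ (a , b) = τ a , τ b

  i<j : i F.< j
  i<j = subst (toℕ i ℕ.<_) (sym j≡1+i) (ℕP.n<1+n (toℕ i))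

  i≢j : i ≢ j
  i≢j = FP.<⇒≢ i<j

  lookup-Q : ∀ k → lookup (pos Q) k ≡ lookup (pos P) (τ k)
  lookup-Q = lookup-swap (pos P) i≢j

  col∘τ : ∀ k → col P (τ k) ≡ col P k
  col∘τ k with which i j k
  ... | is-i refl = trans (cong (col P) (transpose-matchˡ i j)) (sym ci≡cj)
  ... | is-j refl = trans (cong (col P) (transpose-matchʳ i j)) ci≡cj
  ... | neither k≢i k≢j = cong (col P) (transpose-mismatch k≢i k≢j)

  col-Q : ∀ k → col Q k ≡ col P k
  col-Q k = trans (cong proj₂ (lookup-Q k)) (col∘τ k)

  row-Q : ∀ k → row Q k ≡ row P (τ k)
  row-Q k = cong proj₁ (lookup-Q k)

  row-Q∘τ : ∀ k → row Q (τ k) ≡ row P k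
  row-Q∘τ k = trans (row-Q (τ k)) (cong (row P) (transpose-involutive i j k))

  col-Q∘τ : ∀ k → col Q (τ k) ≡ col P k
  col-Q∘τ k = trans (col-Q (τ k)) (col∘τ k)

  Q-isPM : IsPM P → IsPM Q
  Q-isPM (upper , rows , cols , ordered) = upper′ , rows′ , cols′ , ordered′
    where
    upper′ : ∀ k → row Q k F.≤ col Q k
    upper′ k = subst₂ F._≤_ (sym (row-Q k)) (trans (col∘τ k) (sym (col-Q k))) (upper (τ k))
    rows′ : ∀ r → ∃ λ k → row Q k ≡ r
    rows′ r with rows r
    ... | k , rk≡r = τ k , trans (row-Q∘τ k) rk≡r
    cols′ : ∀ c → ∃ λ k → col Q k ≡ c
    cols′ c with cols c
    ... | k , ck≡c = k , trans (col-Q k) ck≡c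
    ordered′ : ∀ a b → col Q a F.< col Q b → a F.< b
    ordered′ a b ca<cb = ordered a b (subst₂ F._<_ (col-Q a) (col-Q b) ca<cb)

  Q-proper : ∀ {k} → Proper P k → Proper Q k
  Q-proper = Proper-resp-col {u = pos P} {pos Q} (sym ∘ col-Q)

  Q-proper⁻ : ∀ {k} → Proper Q k → Proper P k
  Q-proper⁻ = Proper-resp-col {u = pos Q} {pos P} col-Q

  ci≡cj-Q : col Q i ≡ col Q j
  ci≡cj-Q = trans (col-Q i) (trans ci≡cj (sym (col-Q j)))

  swap-swap-pos : pos (swapPos Q i j) ≡ pos P
  swap-swap-pos = begin
    pos (swapPos Q i j)                       ≡⟨ VP.tabulate∘lookup _ ⟨
    V.tabulate (lookup (pos (swapPos Q i j))) ≡⟨ VP.tabulate-cong lookup-back ⟩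
    V.tabulate (lookup (pos P))               ≡⟨ VP.tabulate∘lookup _ ⟩
    pos P                                     ∎
    where
    open ≡-Reasoning
    lookup-back : ∀ k → lookup (pos (swapPos Q i j)) k ≡ lookup (pos P) k
    lookup-back k = trans (lookup-swap (pos Q) i≢j k)
                   (trans (lookup-Q (τ k)) (cong (lookup (pos P)) (transpose-involutive i j k)))

  swap-swap : swapPos Q i j ≡ P
  swap-swap = cong (mkRaw (n P) (m P)) swap-swap-pos

  row-Q-i : row Q i ≡ row P j
  row-Q-i = trans (row-Q i) (cong (row P) (transpose-matchˡ i j))

  row-Q-j : row Q j ≡ row P i
  row-Q-j = trans (row-Q j) (cong (row P) (transpose-matchʳ i j))

  row-Q-other : ∀ {k} → k ≢ i → k ≢ j → row Q k ≡ row P k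
  row-Q-other k≢i k≢j = trans (row-Q _) (cong (row P) (transpose-mismatch k≢i k≢j))

  -- Pairs overlapping (i, j) other than (i, j) itself cannot be proper ascents or descents,
  -- as two adjacent elements of one column are never both proper.
  rows≢-Q⁻ : Proper P i → ∀ {a b} → Proper Q a → AscentOrDescentAt Q a b → row P a ≢ row P b
  rows≢-Q⁻ pi {a} {b} pa (b≡1+a , _ , ca≡cb , ra≢rb) with which i j a | which i j b
  ... | is-i refl | is-j refl = λ e → ra≢rb (trans row-Q-i (trans (sym e) (sym row-Q-j)))
  ... | is-i refl | is-i refl = ⊥-elim (ℕP.1+n≢n (sym b≡1+a))
  ... | is-i refl | neither _ b≢j = ⊥-elim (b≢j (FP.toℕ-injective (trans b≡1+a (sym j≡1+i))))
  ... | is-j refl | _ = ⊥-elim (¬proper-adjacent P j≡1+i ci≡cj pi (Q-proper⁻ pa))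
  ... | neither _ _ | is-i refl =
    ⊥-elim (¬proper-adjacent P b≡1+a (trans (sym (col-Q a)) (trans ca≡cb (col-Q i))) (Q-proper⁻ pa) pi)
  ... | neither a≢i _ | is-j refl =
    ⊥-elim (a≢i (FP.toℕ-injective (ℕP.suc-injective (trans (sym b≡1+a) j≡1+i))))
  ... | neither a≢i a≢j | neither b≢i b≢j =
    λ e → ra≢rb (trans (row-Q-other a≢i a≢j) (trans e (sym (row-Q-other b≢i b≢j))))

  properAD-Q⁻ : Proper P i → ∀ {ab} → ProperAD Q ab → ProperAD P ab
  properAD-Q⁻ pi {a , b} (ad , pa) with ascentOrDescent⁺ Q ad
  ... | ad′@(b≡1+a , 1≤a , ca≡cb , _) =
    ascentOrDescent⁻ P (b≡1+a , 1≤a , trans (sym (col-Q a)) (trans ca≡cb (col-Q b)) , rows≢-Q⁻ pi pa ad′) ,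
    Q-proper⁻ pa

  τ-< : ∀ {a b} → (a , b) ≢ (j , i) → b F.< a → τ b F.< τ a
  τ-< {a} {b} ab≢ji b<a with which i j a | which i j b
  ... | is-i refl | is-i refl = ⊥-elim (FP.<-irrefl refl b<a)
  ... | is-i refl | is-j refl = ⊥-elim (FP.<-asym i<j b<a)
  ... | is-i refl | neither b≢i b≢j =
    subst₂ F._<_ (sym (transpose-mismatch b≢i b≢j)) (sym (transpose-matchˡ i j)) (FP.<-trans b<a i<j)
  ... | is-j refl | is-i refl = ⊥-elim (ab≢ji refl)
  ... | is-j refl | is-j refl = ⊥-elim (FP.<-irrefl refl b<a)
  ... | is-j refl | neither b≢i b≢j =
    subst₂ F._<_ (sym (transpose-mismatch b≢i b≢j)) (sym (transpose-matchʳ i j)) b<i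
    where
    b<i : b F.< i
    b<i = ℕP.≤∧≢⇒< (ℕ.s≤s⁻¹ (subst (suc (toℕ b) ℕ.≤_) j≡1+i b<a)) (b≢i ∘ FP.toℕ-injective)
  ... | neither a≢i a≢j | is-i refl =
    subst₂ F._<_ (sym (transpose-matchˡ i j)) (sym (transpose-mismatch a≢i a≢j)) j<a
    where
    j<a : j F.< a
    j<a = ℕP.≤∧≢⇒< (subst (ℕ._≤ toℕ a) (sym j≡1+i) b<a) (a≢j ∘ sym ∘ FP.toℕ-injective)
  ... | neither a≢i a≢j | is-j refl =
    subst₂ F._<_ (sym (transpose-matchʳ i j)) (sym (transpose-mismatch a≢i a≢j)) (FP.<-trans i<j b<a)
  ... | neither a≢i a≢j | neither b≢i b≢j =
    subst₂ F._<_ (sym (transpose-mismatch b≢i b≢j)) (sym (transpose-mismatch a≢i a≢j)) b<a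

  pair≟ : DecidableEquality (Fin (n P) × Fin (n P))
  pair≟ = ×P.≡-dec FP._≟_ FP._≟_

  σ-involutive : ∀ ab → σ (σ ab) ≡ ab
  σ-involutive (a , b) = cong₂ _,_ (transpose-involutive i j a) (transpose-involutive i j b)

  σ-ij : σ (i , j) ≡ (j , i)
  σ-ij = cong₂ _,_ (transpose-matchˡ i j) (transpose-matchʳ i j)

  σ-ji : σ (j , i) ≡ (i , j)
  σ-ji = cong₂ _,_ (transpose-matchʳ i j) (transpose-matchˡ i j)

  τ-<⁻ : ∀ {a b} → (a , b) ≢ (i , j) → τ b F.< τ a → b F.< a
  τ-<⁻ {a} {b} ab≢ij τb<τa =
    subst₂ F._<_ (transpose-involutive i j b) (transpose-involutive i j a) (τ-< τab≢ji τb<τa)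
    where
    τab≢ji : (τ a , τ b) ≢ (j , i)
    τab≢ji e = ab≢ij (trans (sym (σ-involutive (a , b))) (trans (cong σ e) σ-ji))

  Inversion-σ : ∀ {ab} → ab ≢ (i , j) → ab ≢ (j , i) → Inversion P ab → Inversion Q (σ ab)
  Inversion-σ {a , b} ab≢ij ab≢ji (b<a , ca≡cb , ra<rb) =
    τ-< ab≢ji b<a , trans (col-Q∘τ a) (trans ca≡cb (sym (col-Q∘τ b))) ,
    subst₂ F._<_ (sym (row-Q∘τ a)) (sym (row-Q∘τ b)) ra<rb

  Inversion-σ⁻ : ∀ {ab} → ab ≢ (i , j) → ab ≢ (j , i) → Inversion Q (σ ab) → Inversion P ab
  Inversion-σ⁻ {a , b} ab≢ij ab≢ji (τb<τa , cτa≡cτb , rτa<rτb) =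
    τ-<⁻ ab≢ij τb<τa , trans (sym (col-Q∘τ a)) (trans cτa≡cτb (col-Q∘τ b)) ,
    subst₂ F._<_ (row-Q∘τ a) (row-Q∘τ b) rτa<rτb

  -- The pair (i, j) is the only one whose inversion status changes.
  inv-ascent : row P i F.< row P j → inv Q ≡ suc (inv P)
  inv-ascent ri<rj = begin
    inv Q                                                  ≡⟨ ↭P.↭-length (↭P.filter-↭ (Inversion? Q) allPairs↭) ⟩
    length (filter (Inversion? Q) (map σ (allPairs (n P)))) ≡⟨ length-filter-map (Inversion? Q) σ (allPairs (n P)) ⟩
    length (filter (Inversion? Q ∘ σ) (allPairs (n P)))     ≡⟨ count ⟩
    suc (inv P)                                            ∎
    where
    open ≡-Reasoning
    allPairs↭ : allPairs (n P) ↭ map σ (allPairs (n P))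
    allPairs↭ = involution-↭ (allPairs-unique (n P)) (λ _ → ∈-allPairs _) (λ {ab} _ → σ-involutive ab)
    ¬inv-ij : ¬ Inversion P (i , j)
    ¬inv-ij (j<i , _) = FP.<-asym i<j j<i
    ¬inv-ji : ¬ Inversion P (j , i)
    ¬inv-ji (_ , _ , rj<ri) = FP.<-asym ri<rj rj<ri
    inv-σij : Inversion Q (σ (i , j))
    inv-σij = subst (Inversion Q) (sym σ-ij)
      (i<j , sym ci≡cj-Q , subst₂ F._<_ (sym row-Q-j) (sym row-Q-i) ri<rj)
    ¬inv-σji : ¬ Inversion Q (σ (j , i))
    ¬inv-σji q with subst (Inversion Q) σ-ji q
    ... | j<i , _ = FP.<-asym i<j j<i
    count : length (filter (Inversion? Q ∘ σ) (allPairs (n P))) ≡ suc (inv P)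
    count = length-filter-except pair≟ (Inversion? Q ∘ σ) (Inversion? P)
      (allPairs-unique (n P)) (∈-allPairs (i , j)) inv-σij ¬inv-ij
      (λ {ab} _ ab≢ij → to ab ab≢ij) (λ {ab} _ ab≢ij → from ab ab≢ij)
      where
      to : ∀ ab → ab ≢ (i , j) → Inversion Q (σ ab) → Inversion P ab
      to ab ab≢ij with pair≟ ab (j , i)
      ... | yes refl = ⊥-elim ∘ ¬inv-σji
      ... | no ab≢ji = Inversion-σ⁻ ab≢ij ab≢ji
      from : ∀ ab → ab ≢ (i , j) → Inversion P ab → Inversion Q (σ ab)
      from ab ab≢ij with pair≟ ab (j , i)
      ... | yes refl = ⊥-elim ∘ ¬inv-ji
      ... | no ab≢ji = Inversion-σ ab≢ij ab≢ji

module _ (P : RawPM) (i j : Fin (n P)) (j≡1+i : toℕ j ≡ suc (toℕ i)) (ci≡cj : col P i ≡ col P j) where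
  open AdjacentSwap P i j j≡1+i ci≡cj
  private module Back = AdjacentSwap Q i j j≡1+i ci≡cj-Q

  properADs-swap : Proper P i → properADs Q ≡ properADs P
  properADs-swap pi = LP.filter-≐ (ProperAD? Q) (ProperAD? P) (properAD-Q⁻ pi , properAD-Q) (allPairs (n P))
    where
    properAD-Q : ∀ {ab} → ProperAD P ab → ProperAD Q ab
    properAD-Q {ab} = Back.properAD-Q⁻ (Q-proper pi)
                    ∘ subst (λ v → ProperAD (mkRaw (n P) (m P) v) ab) (sym swap-swap-pos)

  inv-swap : row P i ≢ row P j → inv Q ≡ suc (inv P) ⊎ inv P ≡ suc (inv Q)
  inv-swap ri≢rj with FP.<-cmp (row P i) (row P j)
  ... | tri< ri<rj _ _ = inj₁ (inv-ascent ri<rj)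
  ... | tri≈ _ ri≡rj _ = ⊥-elim (ri≢rj ri≡rj)
  ... | tri> _ _ rj<ri = inj₂ (trans (cong (λ v → inv (mkRaw (n P) (m P) v)) (sym swap-swap-pos))
                                     (Back.inv-ascent (subst₂ F._<_ (sym row-Q-i) (sym row-Q-j) rj<ri)))

Θ-none : ∀ P → properADs P ≡ [] → Θ P ≡ P
Θ-none P eq rewrite eq = refl

Θ-first : ∀ P {i j rest} → properADs P ≡ (i , j) ∷ rest → Θ P ≡ swapPos P i j
Θ-first P eq rewrite eq = refl

-- Facts about Θ are proved by matching on this view: `with` over a goal mentioning Θ P
-- would normalise the decision procedures hidden in Θ P.

data ΘView (P : RawPM) : RawPM → Set where
  none  : properADs P ≡ [] → ΘView P P
  first : ∀ {i j rest} → properADs P ≡ (i , j) ∷ rest → ΘView P (swapPos P i j)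

Θ-view : ∀ P → ΘView P (Θ P)
Θ-view P with properADs P in eq
... | []          = none eq
... | (i , j) ∷ _ = first eq

module FirstProperAD (P : RawPM) {i j rest} (eq : properADs P ≡ (i , j) ∷ rest) where

  properAD : ProperAD P (i , j)
  properAD = proj₂ (∈P.∈-filter⁻ (ProperAD? P) {xs = allPairs (n P)} (subst ((i , j) ∈_) (sym eq) (here refl)))

  private
    ad : AscentOrDescentAt P i j
    ad = ascentOrDescent⁺ P (proj₁ properAD)

  j≡1+i : toℕ j ≡ suc (toℕ i)
  j≡1+i = proj₁ ad

  ci≡cj : col P i ≡ col P j
  ci≡cj = proj₁ (proj₂ (proj₂ ad))

  ri≢rj : row P i ≢ row P j
  ri≢rj = proj₂ (proj₂ (proj₂ ad))

  open AdjacentSwap P i j j≡1+i ci≡cj public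

  ΘQ≡P : Θ Q ≡ P
  ΘQ≡P = trans (Θ-first Q (trans (properADs-swap P i j j≡1+i ci≡cj (proj₂ properAD)) eq)) swap-swap

Θ-involutive : ∀ P → Θ (Θ P) ≡ P
Θ-involutive P = go (Θ-view P)
  where
  go : ∀ {R} → ΘView P R → Θ R ≡ P
  go (none eq)  = Θ-none P eq
  go (first eq) = FirstProperAD.ΘQ≡P P eq

Θ-size : ∀ P → n (Θ P) ≡ n P × m (Θ P) ≡ m P
Θ-size P = go (Θ-view P)
  where
  go : ∀ {R} → ΘView P R → n R ≡ n P × m R ≡ m P
  go (none _)  = refl , refl
  go (first _) = refl , refl

Θ-isPM : ∀ P → IsPM P → IsPM (Θ P)
Θ-isPM P pm = go (Θ-view P)
  where
  go : ∀ {R} → ΘView P R → IsPM R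
  go (none _)   = pm
  go (first eq) = FirstProperAD.Q-isPM P eq pm

Θ-IPPM : ∀ P → IsIPPM P → Θ P ≡ P
Θ-IPPM P (_ , improper) = go (Θ-view P)
  where
  go : ∀ {R} → ΘView P R → R ≡ P
  go (none _)   = refl
  go (first {i} {j} eq) with FirstProperAD.properAD P eq
  ... | d⊎a , proper = ⊥-elim (improper i (Sum.map (j ,_) (j ,_) d⊎a) proper)

IsIPPM-if-none : ∀ P → IsPM P → properADs P ≡ [] → IsIPPM P
IsIPPM-if-none P pm eq = pm , λ { i (inj₁ (j , d)) proper → ∉[] (i , j) (inj₁ d , proper)
                                ; i (inj₂ (j , a)) proper → ∉[] (i , j) (inj₂ a , proper) }
  where
  ∉[] : ∀ ab → ProperAD P ab → ⊥
  ∉[] ab pad with subst (ab ∈_) eq (∈P.∈-filter⁺ (ProperAD? P) (∈-allPairs ab) pad)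
  ... | ()

Θ-inv : ∀ P → IsPM P → ¬ IsIPPM P → inv (Θ P) ≡ suc (inv P) ⊎ inv P ≡ suc (inv (Θ P))
Θ-inv P pm ¬ippm = go (Θ-view P)
  where
  go : ∀ {R} → ΘView P R → inv R ≡ suc (inv P) ⊎ inv P ≡ suc (inv R)
  go (none eq)          = ⊥-elim (¬ippm (IsIPPM-if-none P pm eq))
  go (first {i} {j} eq) = inv-swap P i j j≡1+i ci≡cj ri≢rj
    where open FirstProperAD P eq

Θ-∈-allRaw : ∀ {k P} → P ∈ allRaw k → Θ P ∈ allRaw k
Θ-∈-allRaw {k} {P} P∈ = subst (λ l → Θ P ∈ allRaw l) nΘ≡k (∈-allRaw (Θ P) mΘ≤nΘ)
  where
  nΘ≡k : n (Θ P) ≡ k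
  nΘ≡k = trans (proj₁ (Θ-size P)) (proj₁ (∈-allRaw⁻ P∈))
  mΘ≤nΘ : m (Θ P) ℕ.≤ n (Θ P)
  mΘ≤nΘ = subst₂ ℕ._≤_ (sym (proj₂ (Θ-size P))) (sym nΘ≡k) (proj₂ (∈-allRaw⁻ P∈))

sign : RawPM → ℤ
sign P = -1ℤ ^ inv P

sign-Θ : ∀ P → IsPM P → ¬ IsIPPM P → sign (Θ P) ≡ - sign P
sign-Θ P pm ¬ippm = flip (Θ-inv P pm ¬ippm)
  where
  flip : inv (Θ P) ≡ suc (inv P) ⊎ inv P ≡ suc (inv (Θ P)) → sign (Θ P) ≡ - sign P
  flip (inj₁ invΘ≡) = trans (cong (-1ℤ ^_) invΘ≡) (-1^suc (inv P))
  flip (inj₂ inv≡)  = begin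
    sign (Θ P)                ≡⟨ ℤP.neg-involutive _ ⟨
    - - sign (Θ P)            ≡⟨ cong -_ (-1^suc (inv (Θ P))) ⟨
    - (-1ℤ ^ suc (inv (Θ P))) ≡⟨ cong (λ k → - (-1ℤ ^ k)) inv≡ ⟨
    - sign P                  ∎
    where open ≡-Reasoning

Θ-nonIPPM : ∀ P → IsPM P → ¬ IsIPPM P → ¬ IsIPPM (Θ P)
Θ-nonIPPM P pm ¬ippm ippm = no-step (Θ-inv P pm ¬ippm)
  where
  Θ≡P : Θ P ≡ P
  Θ≡P = trans (sym (Θ-IPPM (Θ P) ippm)) (Θ-involutive P)
  no-step : inv (Θ P) ≡ suc (inv P) ⊎ inv P ≡ suc (inv (Θ P)) → ⊥
  no-step (inj₁ invΘ≡) = ℕP.1+n≢n (trans (sym invΘ≡) (cong inv Θ≡P))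
  no-step (inj₂ inv≡)  = ℕP.1+n≢n (trans (sym inv≡) (cong inv (sym Θ≡P)))

module Pairing (P : RawPM) (pm : IsPM P) where

  col-mono : ∀ {a b} → toℕ a ℕ.≤ toℕ b → col P a F.≤ col P b
  col-mono {a} {b} a≤b = ℕP.≮⇒≥ λ cb<ca → ℕP.<⇒≱ (proj₂ (proj₂ (proj₂ pm)) b a cb<ca) a≤b

  col-between : ∀ {a z b} → toℕ a ℕ.≤ toℕ z → toℕ z ℕ.≤ toℕ b → col P a ≡ col P b → col P z ≡ col P a
  col-between a≤z z≤b ca≡cb = FP.≤-antisym (subst (col P _ F.≤_) (sym ca≡cb) (col-mono z≤b)) (col-mono a≤z)

  column-min : ∀ x → Σ (Fin (n P)) λ w → IsMinInCol P w (col P x)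
  column-min x = least (λ z → col P z FP.≟ col P x) refl

  predecessor-in-column : ∀ {x} → ¬ Proper P x → Σ (Fin (n P)) λ y → toℕ x ≡ suc (toℕ y) × col P y ≡ col P x
  predecessor-in-column {x} ¬px = y , x≡1+y , trans (col-between w≤y y≤x cw≡cx) cw≡cx
    where
    w = proj₁ (column-min x)
    cw≡cx = proj₁ (proj₂ (column-min x))
    w≤x : w F.≤ x
    w≤x = proj₂ (proj₂ (column-min x)) x refl
    w<x : w F.< x
    w<x = ℕP.≤∧≢⇒< w≤x λ w≡x → ¬px (w , proj₂ (column-min x) , cong (λ z → z % 2) w≡x)
    y = proj₁ (predecessor w<x)
    x≡1+y = proj₂ (predecessor w<x)
    w≤y : w F.≤ y
    w≤y = ℕ.s≤s⁻¹ (subst (suc (toℕ w) ℕ.≤_) x≡1+y w<x)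
    y≤x : y F.≤ x
    y≤x = subst (toℕ y ℕ.≤_) (sym x≡1+y) (ℕP.n≤1+n (toℕ y))

  proper-predecessor : ∀ {x y} → ¬ Proper P x → toℕ x ≡ suc (toℕ y) → col P y ≡ col P x → Proper P y
  proper-predecessor {x} {y} ¬px x≡1+y cy≡cx =
    w , (trans cw≡cx (sym cy≡cx) , λ k ck → w≤ k (trans ck cy≡cx)) ,
    trans (%2≢⇒suc-%2 (toℕ x) (toℕ w) (¬px ∘ (λ x≡w → w , (cw≡cx , w≤) , sym x≡w)))
          (trans (cong (λ z → suc z % 2) x≡1+y) (suc-suc-%2 (toℕ y)))
    where
    w = proj₁ (column-min x)
    cw≡cx = proj₁ (proj₂ (column-min x))
    w≤ = proj₂ (proj₂ (column-min x))

  data Partner (x y : Fin (n P)) : Set where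
    next  : Proper P x → toℕ y ≡ suc (toℕ x) → col P y ≡ col P x → Partner x y
    alone : Proper P x → y ≡ x → (∀ z → toℕ z ≡ suc (toℕ x) → col P z ≢ col P x) → Partner x y
    prev  : ¬ Proper P x → toℕ x ≡ suc (toℕ y) → col P y ≡ col P x → Partner x y

  partner : ∀ x → Σ (Fin (n P)) (Partner x)
  partner x with Proper? P x
  ... | no ¬px = let y , x≡1+y , cy≡cx = predecessor-in-column ¬px in y , prev ¬px x≡1+y cy≡cx
  ... | yes px with suc (toℕ x) ℕP.<? n P
  ...   | no ¬x<n = x , alone px refl λ z z≡1+x _ → ¬x<n (subst (ℕ._< n P) z≡1+x (FP.toℕ<n z))
  ...   | yes x<n with col P (F.fromℕ< x<n) FP.≟ col P x
  ...     | yes c≡ = F.fromℕ< x<n , next px (FP.toℕ-fromℕ< x<n) c≡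
  ...     | no c≢  = x , alone px refl λ z z≡1+x cz≡ →
    c≢ (subst (λ q → col P q ≡ col P x) (FP.toℕ-injective (trans z≡1+x (sym (FP.toℕ-fromℕ< x<n)))) cz≡)

  π : Fin (n P) → Fin (n P)
  π x = proj₁ (partner x)

  π-partner : ∀ x → Partner x (π x)
  π-partner x = proj₂ (partner x)

  π-involutive : ∀ x → π (π x) ≡ x
  π-involutive x with π-partner x | π-partner (π x)
  ... | next px y≡1+x cy≡cx | next py _ _ = ⊥-elim (¬proper-adjacent P y≡1+x (sym cy≡cx) px py)
  ... | next px y≡1+x cy≡cx | alone py _ _ = ⊥-elim (¬proper-adjacent P y≡1+x (sym cy≡cx) px py)
  ... | next _ y≡1+x _ | prev _ y≡1+z _ = FP.toℕ-injective (ℕP.suc-injective (trans (sym y≡1+z) y≡1+x))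
  ... | alone _ πx≡x _ | _ = trans (cong π πx≡x) πx≡x
  ... | prev _ x≡1+y _ | next _ z≡1+y _ = FP.toℕ-injective (trans z≡1+y (sym x≡1+y))
  ... | prev _ x≡1+y cy≡cx | alone _ _ last = ⊥-elim (last x x≡1+y (sym cy≡cx))
  ... | prev ¬px x≡1+y cy≡cx | prev ¬py _ _ = ⊥-elim (¬py (proper-predecessor ¬px x≡1+y cy≡cx))

  col-π : ∀ x → col P (π x) ≡ col P x
  col-π x with π-partner x
  ... | next _ _ cy≡cx  = cy≡cx
  ... | alone _ πx≡x _  = cong (col P) πx≡x
  ... | prev _ _ cy≡cx  = cy≡cx

  π≤1+ : ∀ x → toℕ (π x) ℕ.≤ suc (toℕ x)
  π≤1+ x with π-partner x
  ... | next _ y≡1+x _ = ℕP.≤-reflexive y≡1+x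
  ... | alone _ πx≡x _ = subst (λ q → toℕ q ℕ.≤ suc (toℕ x)) (sym πx≡x) (ℕP.n≤1+n _)
  ... | prev _ x≡1+y _ = ℕP.≤-trans (ℕP.n≤1+n _) (ℕP.≤-trans (ℕP.≤-reflexive (sym x≡1+y)) (ℕP.n≤1+n _))

  ≤1+π : ∀ x → toℕ x ℕ.≤ suc (toℕ (π x))
  ≤1+π x with π-partner x
  ... | next _ y≡1+x _ = ℕP.≤-trans (ℕP.n≤1+n _) (ℕP.≤-trans (ℕP.≤-reflexive (sym y≡1+x)) (ℕP.n≤1+n _))
  ... | alone _ πx≡x _ = subst (λ q → toℕ x ℕ.≤ suc (toℕ q)) (sym πx≡x) (ℕP.n≤1+n _)
  ... | prev _ x≡1+y _ = ℕP.≤-reflexive x≡1+y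

  -- Columns are intervals, so an unpaired element is the last of its column.
  π-fixed⇒last : ∀ {a b} → π b ≡ b → col P a ≡ col P b → b F.< a → ⊥
  π-fixed⇒last {a} {b} πb≡b ca≡cb b<a with π-partner b
  ... | next _ y≡1+b _ = ℕP.1+n≢n (trans (sym y≡1+b) (cong toℕ πb≡b))
  ... | prev _ b≡1+y _ = ℕP.1+n≢n (trans (sym b≡1+y) (cong toℕ (sym πb≡b)))
  ... | alone _ _ last = last z z≡1+b (col-between b≤z z≤a (sym ca≡cb))
    where
    z = F.fromℕ< (ℕP.≤-<-trans b<a (FP.toℕ<n a))
    z≡1+b : toℕ z ≡ suc (toℕ b)
    z≡1+b = FP.toℕ-fromℕ< _
    b≤z : toℕ b ℕ.≤ toℕ z
    b≤z = subst (toℕ b ℕ.≤_) (sym z≡1+b) (ℕP.n≤1+n _)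
    z≤a : toℕ z ℕ.≤ toℕ a
    z≤a = subst (ℕ._≤ toℕ a) (sym z≡1+b) b<a

module ImproperInversions (P : RawPM) (ippm : IsIPPM P) where
  open Pairing P (proj₁ ippm)

  toℕ-col-first : ∀ {y} → toℕ y ≡ 0 → toℕ (col P y) ≡ 0
  toℕ-col-first {y} y≡0 =
    ℕP.n≤0⇒n≡0 (subst (toℕ (col P y) ℕ.≤_) (trans (cong toℕ ck≡c0) (FP.toℕ-fromℕ< _)) cy≤ck)
    where
    c0 : Fin (m P)
    c0 = F.fromℕ< (ℕP.≤-<-trans z≤n (FP.toℕ<n (col P y)))
    k = proj₁ (proj₁ (proj₂ (proj₂ (proj₁ ippm))) c0)
    ck≡c0 = proj₂ (proj₁ (proj₂ (proj₂ (proj₁ ippm))) c0)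
    cy≤ck : col P y F.≤ col P k
    cy≤ck = col-mono (subst (ℕ._≤ toℕ k) (sym y≡0) z≤n)

  -- Impropriety is used for y > 0; the element 0 is never an ascent or descent, but it
  -- lies in the first column and hence in the first row.
  row-successor : ∀ {x y} → Proper P y → toℕ x ≡ suc (toℕ y) → col P y ≡ col P x → row P y ≡ row P x
  row-successor {x} {y} py x≡1+y cy≡cx with toℕ y ℕP.≟ 0
  ... | yes y≡0 = FP.toℕ-injective (trans (ℕP.n≤0⇒n≡0 ry≤0) (sym (ℕP.n≤0⇒n≡0 rx≤0)))
    where
    upper = proj₁ (proj₁ ippm)
    ry≤0 : toℕ (row P y) ℕ.≤ 0
    ry≤0 = subst (toℕ (row P y) ℕ.≤_) (toℕ-col-first y≡0) (upper y)
    rx≤0 : toℕ (row P x) ℕ.≤ 0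
    rx≤0 = subst (toℕ (row P x) ℕ.≤_) (trans (cong toℕ (sym cy≡cx)) (toℕ-col-first y≡0)) (upper x)
  ... | no y≢0 with FP.<-cmp (row P y) (row P x)
  ...   | tri≈ _ ry≡rx _ = ry≡rx
  ...   | tri< ry<rx _ _ = ⊥-elim (proj₂ ippm y (inj₂ (x , x≡1+y , ℕP.n≢0⇒n>0 y≢0 , cy≡cx , ry<rx)) py)
  ...   | tri> _ _ rx<ry = ⊥-elim (proj₂ ippm y (inj₁ (x , x≡1+y , ℕP.n≢0⇒n>0 y≢0 , cy≡cx , rx<ry)) py)

  row-π : ∀ x → row P (π x) ≡ row P x
  row-π x with π-partner x
  ... | next px y≡1+x cy≡cx     = sym (row-successor px y≡1+x (sym cy≡cx))
  ... | alone _ πx≡x _          = cong (row P) πx≡x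
  ... | prev ¬px x≡1+y cy≡cx    = row-successor (proper-predecessor ¬px x≡1+y cy≡cx) x≡1+y cy≡cx

  ρ-by : ∀ {a} → Dec (π a ≡ a) → Fin (n P) → Fin (n P) × Fin (n P)
  ρ-by {a} (yes _) b = a , π b
  ρ-by {a} (no _)  b = π a , b

  ρ : Fin (n P) × Fin (n P) → Fin (n P) × Fin (n P)
  ρ (a , b) = ρ-by (π a FP.≟ a) b

  data ρ-View (a b : Fin (n P)) : Set where
    keep : π a ≡ a → ρ (a , b) ≡ (a , π b) → ρ-View a b
    move : π a ≢ a → ρ (a , b) ≡ (π a , b) → ρ-View a b

  ρ-view : ∀ a b → ρ-View a b
  ρ-view a b = go (π a FP.≟ a) refl
    where
    go : (d : Dec (π a ≡ a)) → ρ (a , b) ≡ ρ-by d b → ρ-View a b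
    go (yes πa≡a) ρab≡ = keep πa≡a ρab≡
    go (no πa≢a)  ρab≡ = move πa≢a ρab≡

  ρ-involutive : ∀ ab → ρ (ρ ab) ≡ ab
  ρ-involutive (a , b) with ρ-view a b
  ... | keep πa≡a ρab≡ with ρ-view a (π b)
  ...   | keep _ ρρab≡ = trans (cong ρ ρab≡) (trans ρρab≡ (cong (a ,_) (π-involutive b)))
  ...   | move πa≢a _  = ⊥-elim (πa≢a πa≡a)
  ρ-involutive (a , b) | move πa≢a ρab≡ with ρ-view (π a) b
  ...   | keep ππa≡πa _ = ⊥-elim (πa≢a (trans (sym ππa≡πa) (π-involutive a)))
  ...   | move _ ρρab≡  = trans (cong ρ ρab≡) (trans ρρab≡ (cong (_, b) (π-involutive a)))

  Inversion-ρ : ∀ {ab} → Inversion P ab → Inversion P (ρ ab)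
  Inversion-ρ {a , b} (b<a , ca≡cb , ra<rb) with ρ-view a b
  ... | keep _ ρab≡ = subst (Inversion P) (sym ρab≡) (πb<a , trans ca≡cb (sym (col-π b)) , ra<rπb)
    where
    ra<rπb = subst (row P a F.<_) (sym (row-π b)) ra<rb
    πb<a : π b F.< a
    πb<a = ℕP.≤∧≢⇒< (ℕP.≤-trans (π≤1+ b) b<a)
      λ πb≡a → FP.<-irrefl (cong (row P) (FP.toℕ-injective (sym πb≡a))) ra<rπb
  ... | move _ ρab≡ = subst (Inversion P) (sym ρab≡) (b<πa , trans (col-π a) ca≡cb , rπa<rb)
    where
    rπa<rb = subst (F._< row P b) (sym (row-π a)) ra<rb
    b<πa : b F.< π a
    b<πa = ℕP.≤∧≢⇒< (ℕ.s≤s⁻¹ (ℕP.≤-trans b<a (≤1+π a)))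
      λ b≡πa → FP.<-irrefl (cong (row P) (FP.toℕ-injective (sym b≡πa))) rπa<rb

  index-sum : Fin (n P) × Fin (n P) → ℕ
  index-sum (a , b) = toℕ a + toℕ b

  index-sum-ρ≢ : ∀ {ab} → Inversion P ab → index-sum (ρ ab) ≢ index-sum ab
  index-sum-ρ≢ {a , b} (b<a , ca≡cb , _) with ρ-view a b
  ... | keep _ ρab≡ = λ s≡ →
    π-fixed⇒last (FP.toℕ-injective (ℕP.+-cancelˡ-≡ (toℕ a) _ _ (trans (sym (cong index-sum ρab≡)) s≡))) ca≡cb b<a
  ... | move πa≢a ρab≡ = λ s≡ →
    πa≢a (FP.toℕ-injective (ℕP.+-cancelʳ-≡ (toℕ b) _ _ (trans (sym (cong index-sum ρab≡)) s≡)))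

  inv-even : inv P % 2 ≡ 0
  inv-even = fixedPointFree-length-even (UniqueP.filter⁺ (Inversion? P) (allPairs-unique (n P)))
    (λ ab∈ → ∈P.∈-filter⁺ (Inversion? P) (∈-allPairs _) (Inversion-ρ (inverted ab∈)))
    (λ {ab} _ → ρ-involutive ab) index-sum (index-sum-ρ≢ ∘ inverted)
    where
    inverted : ∀ {ab} → ab ∈ filter (Inversion? P) (allPairs (n P)) → Inversion P ab
    inverted = proj₂ ∘ ∈P.∈-filter⁻ (Inversion? P) {xs = allPairs (n P)}

signedSum≡#IPPMs : ∀ k → signedSum k ≡ + length (IPPMs k)
signedSum≡#IPPMs k = begin
  signedSum k                                                          ≡⟨ sumℤ-partition IsIPPM? sign (PMs k) ⟩
  sumℤ (map sign (IPPMs k)) ℤ.+ sumℤ (map sign nonIPPMs)               ≡⟨ cong₂ ℤ._+_ ippms-sum nonIPPMs-sum ⟩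
  + length (IPPMs k) ℤ.+ + 0                                            ≡⟨ ℤP.+-identityʳ _ ⟩
  + length (IPPMs k)                                                   ∎
  where
  open ≡-Reasoning
  nonIPPMs = filter (¬? ∘ IsIPPM?) (PMs k)
  ippms-sum : sumℤ (map sign (IPPMs k)) ≡ + length (IPPMs k)
  ippms-sum = sumℤ-ones sign (IPPMs k) λ {P} P∈ →
    -1^even (inv P) (ImproperInversions.inv-even P (proj₂ (∈P.∈-filter⁻ IsIPPM? {xs = PMs k} P∈)))
  nonIPPM⁻ : ∀ {P} → P ∈ nonIPPMs → P ∈ allRaw k × IsPM P × ¬ IsIPPM P
  nonIPPM⁻ P∈ = let P∈PMs , ¬ippm = ∈P.∈-filter⁻ (¬? ∘ IsIPPM?) {xs = PMs k} P∈
                    P∈allRaw , pm = ∈P.∈-filter⁻ IsPM? {xs = allRaw k} P∈PMs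
                in P∈allRaw , pm , ¬ippm
  Θ-∈ : ∀ {P} → P ∈ nonIPPMs → Θ P ∈ nonIPPMs
  Θ-∈ {P} P∈ = let P∈allRaw , pm , ¬ippm = nonIPPM⁻ P∈ in
    ∈P.∈-filter⁺ (¬? ∘ IsIPPM?) (∈P.∈-filter⁺ IsPM? (Θ-∈-allRaw {k} P∈allRaw) (Θ-isPM P pm))
      (Θ-nonIPPM P pm ¬ippm)
  nonIPPMs-sum : sumℤ (map sign nonIPPMs) ≡ + 0
  nonIPPMs-sum = sumℤ-signReversing {f = Θ} {xs = nonIPPMs}
    (UniqueP.filter⁺ (¬? ∘ IsIPPM?) {xs = PMs k} (UniqueP.filter⁺ IsPM? {xs = allRaw k} (allRaw-unique k)))
    Θ-∈ (λ {P} _ → Θ-involutive P)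
    sign λ {P} P∈ → let _ , pm , ¬ippm = nonIPPM⁻ P∈ in sign-Θ P pm ¬ippm

theorem2p3 : ((P : RawPM) → IsPM P → IsPM (Θ P) × weight (Θ P) ≡ weight P × Θ (Θ P) ≡ P)
    × ((P : RawPM) → IsIPPM P → Θ P ≡ P)
    × ((P : RawPM) → IsPM P → ¬ IsIPPM P → ∣ inv P - inv (Θ P) ∣ ≡ 1)
    × ((P : RawPM) → IsIPPM P → inv P % 2 ≡ 0)
    × ((k : ℕ) → 1 ≤ k → + length (IPPMs k) ≡ signedSum k)
theorem2p3 =
  (λ P pm → Θ-isPM P pm , proj₁ (Θ-size P) , Θ-involutive P) ,
  Θ-IPPM ,
  (λ P pm ¬ippm → ∣m-n∣≡1 (Θ-inv P pm ¬ippm)) ,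
  (λ P ippm → ImproperInversions.inv-even P ippm) ,
  -- the identity also holds for k = 0
  (λ k _ → sym (signedSum≡#IPPMs k))
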